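{- Let $f_n$ be the number of rows with the value "false" in the truth tables of all bracketed implications with $n$ distinct variables. Then the generating function $F(x)=\sum_{n\ge1}f_nx^n$ is given by \[F(x)=\frac{ -1-\sqrt{1-8x}+\sqrt{2+2\sqrt{1-8x}+8x}}{4}.\]
   Context: Truth values are written $1$ (true) and $0$ (false). For any valuation $\nu$ (assignment of $0/1$ values to variables, extended to formulae), $\nu(\phi\to\psi)=0$ if $\nu(\phi)=1$ and $\nu(\psi)=0$, and $1$ otherwise. A bracketed implication in $n$ distinct variables $p_1,\ldots,p_n$ is a well-formed formula obtained from $p_1\to p_2\to\cdots\to p_n$ (fixed order) by inserting brackets; equivalently $p_1$ if $n=1$, and for $n\ge 2$ a formula $\psi\to\chi$ with $\psi$ a bracketed implication in $p_1,\ldots,p_r$ and $\chi$ one in $p_{r+1},\ldots,p_n$ for some $1\le r<n$. The truth table of such a formula has $2^n$ rows, one per valuation; $f_n$ counts, summed over all bracketed implications in $n$ variables, the valuations giving the formula value $0$. Square roots denote the branches with $\sqrt{1}=1$ near $x=0$ (so that $F(0)=0$). -}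

module Defs where

open import Data.Bool using (Bool; true; false; not; _∧_; if_then_else_)
open import Data.Nat using (ℕ; zero; suc; _+_; _∸_)
open import Data.List using (List; []; _∷_; map; concatMap; upTo; foldr)
open import Data.Nat.ListAction using (sum)
open import Data.Integer using (+_)
open import Data.Rational using (ℚ; 0ℚ; 1ℚ; _/_) renaming (_+_ to _+ℚ_; _*_ to _*ℚ_; _-_ to _-ℚ_)

-- Bracketed implications: binary trees whose leaves are the variables
-- p₁,…,pₙ read left to right (the fixed order).

data Tree : Set where
  leaf : Tree
  _⇒_  : Tree → Tree → Tree

leaves : Tree → ℕ
leaves leaf    = 1
leaves (l ⇒ r) = leaves l + leaves r

-- trees k n : all trees with exactly n leaves (k is fuel; k ≥ n suffices).
-- For n ≥ 2 the root splits as ψ → χ with ψ on p₁..p_r, χ on p_{r+1}..p_n, 1 ≤ r < n.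
trees : ℕ → ℕ → List Tree
trees zero    n               = []
trees (suc k) zero            = []
trees (suc k) (suc zero)      = leaf ∷ []
trees (suc k) (suc (suc m))   =
  concatMap (λ r → concatMap (λ l → map (l ⇒_) (trees k (suc (suc m) ∸ r)))
                             (trees k r))
            (map suc (upTo (suc m)))

bracketed : ℕ → List Tree
bracketed n = trees n n

-- Valuations: a valuation of p₁..pₙ is a list of n booleans (pᵢ ↦ i-th entry,
-- 0-indexed); allVals n lists all 2ⁿ of them.

allVals : ℕ → List (List Bool)
allVals zero    = [] ∷ []
allVals (suc n) = concatMap (λ v → (false ∷ v) ∷ (true ∷ v) ∷ []) (allVals n)

val : List Bool → ℕ → Bool
val []       _       = false
val (b ∷ _)  zero    = b
val (_ ∷ bs) (suc i) = val bs i

imp : Bool → Bool → Bool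
imp true  false = false
imp _     _     = true

-- eval t o ν : value of t whose leftmost variable is p_{o} (0-indexed).
eval : Tree → ℕ → List Bool → Bool
eval leaf    o ν = val ν o
eval (l ⇒ r) o ν = imp (eval l o ν) (eval r (o + leaves l) ν)

falseRows : ℕ → Tree → ℕ
falseRows n t = sum (map (λ ν → if eval t 0 ν then 0 else 1) (allVals n))

f : ℕ → ℕ
f n = sum (map (falseRows n) (bracketed n))

Series : Set
Series = ℕ → ℚ

ℕtoℚ : ℕ → ℚ
ℕtoℚ n = + n / 1

_*ₛ_ : Series → Series → Series
(a *ₛ b) n = foldr _+ℚ_ 0ℚ (map (λ i → a i *ℚ b (n ∸ i)) (upTo (suc n)))

F : Series
F zero    = 0ℚ
F (suc n) = ℕtoℚ (f (suc n))

oneMinus8x : Series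
oneMinus8x zero          = 1ℚ
oneMinus8x (suc zero)    = 0ℚ -ℚ ℕtoℚ 8
oneMinus8x (suc (suc _)) = 0ℚ

inner : Series → Series
inner s zero          = ℕtoℚ 2 +ℚ ℕtoℚ 2 *ℚ s zero
inner s (suc zero)    = ℕtoℚ 2 *ℚ s (suc zero) +ℚ ℕtoℚ 8
inner s (suc (suc n)) = ℕtoℚ 2 *ℚ s (suc (suc n))

one : Series
one zero    = 1ℚ
one (suc _) = 0ℚ

-- s is the branch of √(1-8x) with value 1 at x = 0
IsSqrt1 : Series → Set
IsSqrt1 s = (∀ n → (s *ₛ s) n ≡ oneMinus8x n) × (s 0 ≡ 1ℚ)
  where open import Relation.Binary.PropositionalEquality using (_≡_)
        open import Data.Product using (_×_)

-- u is the branch of √(2+2s+8x) with value √4 = 2 at x = 0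
IsSqrt2 : Series → Series → Set
IsSqrt2 s u = (∀ n → (u *ₛ u) n ≡ inner s n) × (u 0 ≡ ℕtoℚ 2)
  where open import Relation.Binary.PropositionalEquality using (_≡_)
        open import Data.Product using (_×_)

rhs : Series → Series → Series
rhs s u n = ((0ℚ -ℚ one n) -ℚ s n +ℚ u n) *ℚ (+ 1 / 4)

module Submission where

-- Splitting a bracketed implication at its root ψ → χ, a row is false exactly when ψ is true and
-- χ is false, and ψ, χ read disjoint blocks of variables. Hence the generating functions G, F, K
-- of true, false and all rows satisfy F = x + G F, G + F = K and (since a tree on n variables has
-- 2ⁿ rows) K = 2x + K². Then s = 1 − 2K has s² = 1 − 8x, u = 4F + 1 + s has u² = 2 + 2s + 8x, and
-- F = (−1 − s + u)/4. A power series square root is determined by its constant term when twice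
-- that term is invertible, so any other pair of roots with the prescribed constants is (s, u).

open import Defs
open import Data.Product using (_×_; ∃₂; _,_)
open import Relation.Binary.PropositionalEquality
  using (_≡_; _≗_; refl; sym; trans; cong; cong₂; module ≡-Reasoning)
open import Function using (_∘_)

module Counting where

  open import Data.Bool using (Bool; true; false; if_then_else_)
  open import Data.Nat using (ℕ; zero; suc; _+_; _*_; _∸_; _^_; _≤_; _<_; s≤s)
  import Data.Nat.Properties as ℕ
  open import Data.List using (List; []; _∷_; _++_; map; concat; concatMap; upTo; length)
  import Data.List.Properties as List
  open import Data.List.Relation.Unary.All as All using (All; []; _∷_)
  import Data.List.Relation.Unary.All.Properties as All
  open import Data.Nat.ListAction using (sum)
  open import Data.Nat.ListAction.Properties using (sum-++)
  open import Algebra.Properties.CommutativeSemigroup ℕ.+-commutativeSemigroup using (interchange)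
  open ≡-Reasoning

  module _ {A : Set} where

    sum-map-cong : {g h : A → ℕ} (xs : List A) → g ≗ h → sum (map g xs) ≡ sum (map h xs)
    sum-map-cong xs g≗h = cong sum (List.map-cong g≗h xs)

    sum-map-cong-All : {g h : A → ℕ} {xs : List A} →
                       All (λ x → g x ≡ h x) xs → sum (map g xs) ≡ sum (map h xs)
    sum-map-cong-All = cong sum ∘ List.map-cong-local

    sum-map-+ : (g h : A → ℕ) (xs : List A) →
                sum (map (λ x → g x + h x) xs) ≡ sum (map g xs) + sum (map h xs)
    sum-map-+ g h []       = refl
    sum-map-+ g h (x ∷ xs) =
      trans (cong (g x + h x +_) (sum-map-+ g h xs)) (interchange (g x) (h x) _ _)

    sum-map-*ˡ : (c : ℕ) (h : A → ℕ) (xs : List A) →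
                 sum (map (λ x → c * h x) xs) ≡ c * sum (map h xs)
    sum-map-*ˡ c h []       = sym (ℕ.*-zeroʳ c)
    sum-map-*ˡ c h (x ∷ xs) =
      trans (cong (c * h x +_) (sum-map-*ˡ c h xs)) (sym (ℕ.*-distribˡ-+ c (h x) _))

    sum-map-*ʳ : (c : ℕ) (h : A → ℕ) (xs : List A) →
                 sum (map (λ x → h x * c) xs) ≡ sum (map h xs) * c
    sum-map-*ʳ c h xs = begin
      sum (map (λ x → h x * c) xs) ≡⟨ sum-map-cong xs (λ x → ℕ.*-comm (h x) c) ⟩
      sum (map (λ x → c * h x) xs) ≡⟨ sum-map-*ˡ c h xs ⟩
      c * sum (map h xs)           ≡⟨ ℕ.*-comm c _ ⟩
      sum (map h xs) * c           ∎

  sum-map-concatMap : {A B : Set} (h : B → ℕ) (g : A → List B) (xs : List A) →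
                      sum (map h (concatMap g xs)) ≡ sum (map (λ x → sum (map h (g x))) xs)
  sum-map-concatMap h g []       = refl
  sum-map-concatMap h g (x ∷ xs) = begin
    sum (map h (g x ++ concatMap g xs))
      ≡⟨ cong sum (List.map-++ h (g x) (concatMap g xs)) ⟩
    sum (map h (g x) ++ map h (concatMap g xs))
      ≡⟨ sum-++ (map h (g x)) _ ⟩
    sum (map h (g x)) + sum (map h (concatMap g xs))
      ≡⟨ cong (sum (map h (g x)) +_) (sum-map-concatMap h g xs) ⟩
    sum (map h (g x)) + sum (map (λ x → sum (map h (g x))) xs) ∎

  sumVals : ℕ → (List Bool → ℕ) → ℕ
  sumVals n h = sum (map h (allVals n))

  sumVals-suc : ∀ n h → sumVals (suc n) h ≡ sumVals n (λ v → h (false ∷ v) + h (true ∷ v))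
  sumVals-suc n h = trans (sum-map-concatMap h _ (allVals n))
    (sum-map-cong (allVals n) (λ v → cong (h (false ∷ v) +_) (ℕ.+-identityʳ (h (true ∷ v)))))

  allVals-length : ∀ n → All (λ v → length v ≡ n) (allVals n)
  allVals-length zero    = refl ∷ []
  allVals-length (suc n) =
    All.concat⁺ (All.map⁺ (All.map (λ p → cong suc p ∷ cong suc p ∷ []) (allVals-length n)))

  sumVals-++ : ∀ a b h → sumVals (a + b) h ≡ sumVals b (λ v₂ → sumVals a (λ v₁ → h (v₁ ++ v₂)))
  sumVals-++ zero    b h = sum-map-cong (allVals b) (λ v → sym (ℕ.+-identityʳ (h v)))
  sumVals-++ (suc a) b h = begin
    sumVals (suc a + b) h
      ≡⟨ sumVals-suc (a + b) h ⟩
    sumVals (a + b) (λ v → h (false ∷ v) + h (true ∷ v))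
      ≡⟨ sumVals-++ a b _ ⟩
    sumVals b (λ v₂ → sumVals a (λ v₁ → h (false ∷ v₁ ++ v₂) + h (true ∷ v₁ ++ v₂)))
      ≡⟨ sum-map-cong (allVals b) (λ v₂ → sym (sumVals-suc a (λ v₁ → h (v₁ ++ v₂)))) ⟩
    sumVals b (λ v₂ → sumVals (suc a) (λ v₁ → h (v₁ ++ v₂))) ∎

  sumVals-1 : ∀ n → sumVals n (λ _ → 1) ≡ 2 ^ n
  sumVals-1 zero    = refl
  sumVals-1 (suc n) = begin
    sumVals (suc n) (λ _ → 1)   ≡⟨ sumVals-suc n (λ _ → 1) ⟩
    sumVals n (λ _ → 2 * 1)     ≡⟨ sum-map-*ˡ 2 (λ _ → 1) (allVals n) ⟩
    2 * sumVals n (λ _ → 1)     ≡⟨ cong (2 *_) (sumVals-1 n) ⟩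
    2 * 2 ^ n                   ∎

  val-++ˡ : ∀ v₁ v₂ i → i < length v₁ → val (v₁ ++ v₂) i ≡ val v₁ i
  val-++ˡ (b ∷ v₁) v₂ zero    _         = refl
  val-++ˡ (b ∷ v₁) v₂ (suc i) (s≤s i<n) = val-++ˡ v₁ v₂ i i<n

  val-++ʳ : ∀ v₁ v₂ i → val (v₁ ++ v₂) (length v₁ + i) ≡ val v₂ i
  val-++ʳ []       v₂ i = refl
  val-++ʳ (b ∷ v₁) v₂ i = val-++ʳ v₁ v₂ i

  eval-++ˡ : ∀ t o v₁ v₂ → o + leaves t ≤ length v₁ → eval t o (v₁ ++ v₂) ≡ eval t o v₁
  eval-++ˡ leaf    o v₁ v₂ o+1≤n = val-++ˡ v₁ v₂ o (ℕ.≤-trans (ℕ.≤-reflexive (ℕ.+-comm 1 o)) o+1≤n)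
  eval-++ˡ (l ⇒ r) o v₁ v₂ o+n≤n = cong₂ imp
    (eval-++ˡ l o v₁ v₂ (ℕ.≤-trans (ℕ.+-monoʳ-≤ o (ℕ.m≤m+n (leaves l) (leaves r))) o+n≤n))
    (eval-++ˡ r (o + leaves l) v₁ v₂ (ℕ.≤-trans (ℕ.≤-reflexive (ℕ.+-assoc o _ _)) o+n≤n))

  eval-++ʳ : ∀ t o v₁ v₂ → eval t (length v₁ + o) (v₁ ++ v₂) ≡ eval t o v₂
  eval-++ʳ leaf    o v₁ v₂ = val-++ʳ v₁ v₂ o
  eval-++ʳ (l ⇒ r) o v₁ v₂ = cong₂ imp (eval-++ʳ l o v₁ v₂)
    (trans (cong (λ k → eval r k (v₁ ++ v₂)) (ℕ.+-assoc (length v₁) o (leaves l)))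
           (eval-++ʳ r (o + leaves l) v₁ v₂))

  𝟙[_] 𝟙[¬_] : Bool → ℕ
  𝟙[ b ]  = if b then 1 else 0
  𝟙[¬ b ] = if b then 0 else 1

  𝟙[¬imp] : ∀ x y → 𝟙[¬ imp x y ] ≡ 𝟙[ x ] * 𝟙[¬ y ]
  𝟙[¬imp] true  true  = refl
  𝟙[¬imp] true  false = refl
  𝟙[¬imp] false true  = refl
  𝟙[¬imp] false false = refl

  trueRows : ℕ → Tree → ℕ
  trueRows n t = sumVals n (λ ν → 𝟙[ eval t 0 ν ])

  falseRows-⇒ : ∀ l r → falseRows (leaves l + leaves r) (l ⇒ r) ≡ trueRows (leaves l) l * falseRows (leaves r) r
  falseRows-⇒ l r = begin
    sumVals (a + b) (λ ν → 𝟙[¬ eval (l ⇒ r) 0 ν ])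
      ≡⟨ sumVals-++ a b _ ⟩
    sumVals b (λ v₂ → sumVals a (λ v₁ → 𝟙[¬ eval (l ⇒ r) 0 (v₁ ++ v₂) ]))
      ≡⟨ sum-map-cong (allVals b) (λ v₂ → sum-map-cong-All (All.map (factor v₂) (allVals-length a))) ⟩
    sumVals b (λ v₂ → sumVals a (λ v₁ → 𝟙[ eval l 0 v₁ ] * 𝟙[¬ eval r 0 v₂ ]))
      ≡⟨ sum-map-cong (allVals b) (λ v₂ → sum-map-*ʳ _ _ (allVals a)) ⟩
    sumVals b (λ v₂ → trueRows a l * 𝟙[¬ eval r 0 v₂ ])
      ≡⟨ sum-map-*ˡ (trueRows a l) _ (allVals b) ⟩
    trueRows a l * falseRows b r ∎
    where
    a = leaves l
    b = leaves r
    factor : ∀ v₂ {v₁} → length v₁ ≡ a →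
             𝟙[¬ eval (l ⇒ r) 0 (v₁ ++ v₂) ] ≡ 𝟙[ eval l 0 v₁ ] * 𝟙[¬ eval r 0 v₂ ]
    factor v₂ {v₁} |v₁|≡a = trans
      (cong₂ (λ x y → 𝟙[¬ imp x y ])
        (eval-++ˡ l 0 v₁ v₂ (ℕ.≤-reflexive (sym |v₁|≡a)))
        (trans (cong (λ k → eval r k (v₁ ++ v₂)) (sym (trans (ℕ.+-identityʳ _) |v₁|≡a)))
               (eval-++ʳ r 0 v₁ v₂)))
      (𝟙[¬imp] (eval l 0 v₁) (eval r 0 v₂))

  trueRows+falseRows : ∀ n t → trueRows n t + falseRows n t ≡ 2 ^ n
  trueRows+falseRows n t = begin
    trueRows n t + falseRows n t                      ≡⟨ sym (sum-map-+ _ _ (allVals n)) ⟩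
    sumVals n (λ ν → 𝟙[ eval t 0 ν ] + 𝟙[¬ eval t 0 ν ]) ≡⟨ sum-map-cong (allVals n) (𝟙+𝟙¬ ∘ eval t 0) ⟩
    sumVals n (λ _ → 1)                               ≡⟨ sumVals-1 n ⟩
    2 ^ n                                             ∎
    where
    𝟙+𝟙¬ : ∀ b → 𝟙[ b ] + 𝟙[¬ b ] ≡ 1
    𝟙+𝟙¬ true  = refl
    𝟙+𝟙¬ false = refl

  splits : ℕ → List ℕ
  splits m = map suc (upTo (suc m))

  All-splits : ∀ {P : ℕ → Set} m → (∀ i → i ≤ m → P (suc i)) → All P (splits m)
  All-splits m P-suc = All.map⁺ (All.applyUpTo⁺₁ _ (suc m) (λ i<1+m → P-suc _ (ℕ.≤-pred i<1+m)))

  trees-fuel : ∀ k k′ n → n ≤ k → n ≤ k′ → trees k n ≡ trees k′ n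
  trees-fuel zero    zero     n                   _         _          = refl
  trees-fuel zero    (suc k′) zero                _         _          = refl
  trees-fuel (suc k) zero     zero                _         _          = refl
  trees-fuel (suc k) (suc k′) zero                _         _          = refl
  trees-fuel (suc k) (suc k′) (suc zero)          _         _          = refl
  trees-fuel (suc k) (suc k′) (suc (suc m)) (s≤s n≤k) (s≤s n≤k′) =
    cong concat (List.map-cong-local (All-splits m same-block))
    where
    same-fuel : ∀ {j} → j ≤ suc m → trees k j ≡ trees k′ j
    same-fuel j≤n = trees-fuel k k′ _ (ℕ.≤-trans j≤n n≤k) (ℕ.≤-trans j≤n n≤k′)
    same-block : ∀ i → i ≤ m →
      concatMap (λ l → map (l ⇒_) (trees k (suc m ∸ i))) (trees k (suc i)) ≡
      concatMap (λ l → map (l ⇒_) (trees k′ (suc m ∸ i))) (trees k′ (suc i))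
    same-block i i≤m =
      cong₂ (λ L R → concatMap (λ l → map (l ⇒_) R) L)
            (same-fuel (s≤s i≤m)) (same-fuel (ℕ.m∸n≤m (suc m) i))

  trees-leaves : ∀ k n → All (λ t → leaves t ≡ n) (trees k n)
  trees-leaves zero    n             = []
  trees-leaves (suc k) zero          = []
  trees-leaves (suc k) (suc zero)    = refl ∷ []
  trees-leaves (suc k) (suc (suc m)) = All.concat⁺ (All.map⁺ (All-splits m block-leaves))
    where
    block-leaves : ∀ i → i ≤ m →
      All (λ t → leaves t ≡ suc (suc m)) (concatMap (λ l → map (l ⇒_) (trees k (suc m ∸ i))) (trees k (suc i)))
    block-leaves i i≤m = All.concat⁺ (All.map⁺ (All.map
      (λ |l|≡a → All.map⁺ (All.map
        (λ |r|≡b → trans (cong₂ _+_ |l|≡a |r|≡b) (ℕ.m+[n∸m]≡n (s≤s (ℕ.m≤n⇒m≤1+n i≤m))))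
        (trees-leaves k (suc m ∸ i))))
      (trees-leaves k (suc i))))

  total : (ℕ → Tree → ℕ) → ℕ → ℕ
  total w n = sum (map (w n) (bracketed n))

  module _ (w u v : ℕ → Tree → ℕ)
           (w-⇒ : ∀ l r → w (leaves l + leaves r) (l ⇒ r) ≡ u (leaves l) l * v (leaves r) r) where

    w-⇒-at : ∀ {l r a b n} → leaves l ≡ a → leaves r ≡ b → a + b ≡ n → w n (l ⇒ r) ≡ u a l * v b r
    w-⇒-at {l} {r} refl refl refl = w-⇒ l r

    sum-⇒ : ∀ {a b n Ls Rs} → a + b ≡ n →
            All (λ t → leaves t ≡ a) Ls → All (λ t → leaves t ≡ b) Rs →
            sum (map (w n) (concatMap (λ l → map (l ⇒_) Rs) Ls)) ≡ sum (map (u a) Ls) * sum (map (v b) Rs)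
    sum-⇒ {a} {b} {n} {Ls} {Rs} a+b≡n Ls-leaves Rs-leaves = begin
      sum (map (w n) (concatMap (λ l → map (l ⇒_) Rs) Ls))
        ≡⟨ sum-map-concatMap (w n) _ Ls ⟩
      sum (map (λ l → sum (map (w n) (map (l ⇒_) Rs))) Ls)
        ≡⟨ sum-map-cong-All (All.map row Ls-leaves) ⟩
      sum (map (λ l → u a l * sum (map (v b) Rs)) Ls)
        ≡⟨ sum-map-*ʳ _ (u a) Ls ⟩
      sum (map (u a) Ls) * sum (map (v b) Rs) ∎
      where
      row : ∀ {l} → leaves l ≡ a → sum (map (w n) (map (l ⇒_) Rs)) ≡ u a l * sum (map (v b) Rs)
      row {l} |l|≡a = begin
        sum (map (w n) (map (l ⇒_) Rs))         ≡⟨ cong sum (sym (List.map-∘ Rs)) ⟩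
        sum (map (λ r → w n (l ⇒ r)) Rs)        ≡⟨ sum-map-cong-All (All.map (λ |r|≡b → w-⇒-at |l|≡a |r|≡b a+b≡n) Rs-leaves) ⟩
        sum (map (λ r → u a l * v b r) Rs)      ≡⟨ sum-map-*ˡ (u a l) (v b) Rs ⟩
        u a l * sum (map (v b) Rs)              ∎

    total-⇒ : ∀ m → total w (suc (suc m)) ≡
              sum (map (λ r → total u r * total v (suc (suc m) ∸ r)) (splits m))
    total-⇒ m = trans (sum-map-concatMap (w (suc (suc m))) products (splits m))
                      (sum-map-cong-All (All-splits m block))
      where
      products : ℕ → List Tree
      products r = concatMap (λ l → map (l ⇒_) (trees (suc m) (suc (suc m) ∸ r))) (trees (suc m) r)
      block : ∀ i → i ≤ m →
        sum (map (w (suc (suc m))) (products (suc i))) ≡ total u (suc i) * total v (suc m ∸ i)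
      block i i≤m = begin
        sum (map (w (suc (suc m))) (products (suc i)))
          ≡⟨ sum-⇒ (ℕ.m+[n∸m]≡n (s≤s (ℕ.m≤n⇒m≤1+n i≤m))) (trees-leaves (suc m) (suc i)) (trees-leaves (suc m) (suc m ∸ i)) ⟩
        sum (map (u (suc i)) (trees (suc m) (suc i))) * sum (map (v (suc m ∸ i)) (trees (suc m) (suc m ∸ i)))
          ≡⟨ cong₂ (λ L R → sum (map (u (suc i)) L) * sum (map (v (suc m ∸ i)) R))
                   (trees-fuel (suc m) (suc i) (suc i) (s≤s i≤m) ℕ.≤-refl)
                   (trees-fuel (suc m) (suc m ∸ i) (suc m ∸ i) (ℕ.m∸n≤m (suc m) i) ℕ.≤-refl) ⟩
        total u (suc i) * total v (suc m ∸ i) ∎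

  rows : ℕ → Tree → ℕ
  rows n _ = 2 ^ n

  total-rows-⇒ : ∀ m → total rows (suc (suc m)) ≡
                 sum (map (λ r → total rows r * total rows (suc (suc m) ∸ r)) (splits m))
  total-rows-⇒ = total-⇒ rows rows rows (λ l r → ℕ.^-distribˡ-+-* 2 (leaves l) (leaves r))

  f-⇒ : ∀ m → f (suc (suc m)) ≡ sum (map (λ r → total trueRows r * f (suc (suc m) ∸ r)) (splits m))
  f-⇒ = total-⇒ falseRows trueRows falseRows falseRows-⇒

  total-trueRows+f : ∀ n → total trueRows n + f n ≡ total rows n
  total-trueRows+f n = trans (sym (sum-map-+ _ _ (bracketed n)))
                             (sum-map-cong (bracketed n) (trueRows+falseRows n))

open Counting using (total; rows; trueRows; splits; total-rows-⇒; f-⇒; total-trueRows+f)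

open import Data.Nat as ℕ using (ℕ; zero; suc; _∸_; _≤_; _<_; s≤s)
import Data.Nat.Properties as ℕₚ
import Data.Nat.Coprimality as Coprimality
import Data.Integer as ℤ
import Data.Integer.Properties as ℤₚ
open import Data.List using (map; foldr; applyUpTo)
import Data.List.Properties as List
open import Data.Nat.ListAction using (sum)
open import Data.Rational using (ℚ; 0ℚ; 1ℚ; _+_; _*_; -_; _-_; _/_; 1/_; NonZero; toℚᵘ)
open import Data.Rational.Properties
import Data.Rational.Unnormalised as ℚᵘ
import Data.Rational.Unnormalised.Properties as ℚᵘₚ
open import Algebra.Bundles using (CommutativeMonoid)
open import Algebra.Properties.CommutativeSemigroup (CommutativeMonoid.commutativeSemigroup +-0-commutativeMonoid)
  using (interchange)
open import Algebra.Properties.Group +-0-group using (∙-cancelʳ)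
open import Data.Rational.Solver using (module +-*-Solver)
open +-*-Solver using (solve; _:=_; _:+_; _:*_; _:-_; con)

ℕtoℚ-toℚᵘ : ∀ n → toℚᵘ (ℕtoℚ n) ≡ ℚᵘ.mkℚᵘ (ℤ.+ n) 0
ℕtoℚ-toℚᵘ n = cong toℚᵘ (normalize-coprime (Coprimality.sym (Coprimality.1-coprimeTo n)))

ℕtoℚ-+ : ∀ a b → ℕtoℚ (a ℕ.+ b) ≡ ℕtoℚ a + ℕtoℚ b
ℕtoℚ-+ a b = toℚᵘ-injective (begin
  toℚᵘ (ℕtoℚ (a ℕ.+ b))                  ≡⟨ ℕtoℚ-toℚᵘ (a ℕ.+ b) ⟩
  ℚᵘ.mkℚᵘ (ℤ.+ (a ℕ.+ b)) 0                 ≈⟨ ℚᵘ.*≡* (cong (ℤ._* ℤ.+ 1) sum-num) ⟩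
  ℚᵘ.mkℚᵘ (ℤ.+ a) 0 ℚᵘ.+ ℚᵘ.mkℚᵘ (ℤ.+ b) 0  ≡⟨ sym (cong₂ ℚᵘ._+_ (ℕtoℚ-toℚᵘ a) (ℕtoℚ-toℚᵘ b)) ⟩
  toℚᵘ (ℕtoℚ a) ℚᵘ.+ toℚᵘ (ℕtoℚ b)       ≈⟨ ℚᵘₚ.≃-sym (toℚᵘ-homo-+ (ℕtoℚ a) (ℕtoℚ b)) ⟩
  toℚᵘ (ℕtoℚ a + ℕtoℚ b)                 ∎)
  where
  open ℚᵘₚ.≃-Reasoning
  sum-num : ℤ.+ (a ℕ.+ b) ≡ ℤ.+ a ℤ.* ℤ.+ 1 ℤ.+ ℤ.+ b ℤ.* ℤ.+ 1
  sum-num = trans (ℤₚ.pos-+ a b) (sym (cong₂ ℤ._+_ (ℤₚ.*-identityʳ (ℤ.+ a)) (ℤₚ.*-identityʳ (ℤ.+ b))))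

ℕtoℚ-* : ∀ a b → ℕtoℚ (a ℕ.* b) ≡ ℕtoℚ a * ℕtoℚ b
ℕtoℚ-* a b = toℚᵘ-injective (begin
  toℚᵘ (ℕtoℚ (a ℕ.* b))                  ≡⟨ ℕtoℚ-toℚᵘ (a ℕ.* b) ⟩
  ℚᵘ.mkℚᵘ (ℤ.+ (a ℕ.* b)) 0                 ≈⟨ ℚᵘ.*≡* (cong (ℤ._* ℤ.+ 1) (ℤₚ.pos-* a b)) ⟩
  ℚᵘ.mkℚᵘ (ℤ.+ a) 0 ℚᵘ.* ℚᵘ.mkℚᵘ (ℤ.+ b) 0  ≡⟨ sym (cong₂ ℚᵘ._*_ (ℕtoℚ-toℚᵘ a) (ℕtoℚ-toℚᵘ b)) ⟩
  toℚᵘ (ℕtoℚ a) ℚᵘ.* toℚᵘ (ℕtoℚ b)       ≈⟨ ℚᵘₚ.≃-sym (toℚᵘ-homo-* (ℕtoℚ a) (ℕtoℚ b)) ⟩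
  toℚᵘ (ℕtoℚ a * ℕtoℚ b)                 ∎)
  where
  open ℚᵘₚ.≃-Reasoning

∑ : ℕ → (ℕ → ℚ) → ℚ
∑ zero    g = 0ℚ
∑ (suc n) g = g 0 + ∑ n (g ∘ suc)

∑-cong : ∀ n {g h : ℕ → ℚ} → (∀ i → i < n → g i ≡ h i) → ∑ n g ≡ ∑ n h
∑-cong zero    _   = refl
∑-cong (suc n) g≡h = cong₂ _+_ (g≡h 0 (s≤s ℕ.z≤n)) (∑-cong n (λ i i<n → g≡h (suc i) (s≤s i<n)))

∑-+ : ∀ n g h → ∑ n (λ i → g i + h i) ≡ ∑ n g + ∑ n h
∑-+ zero    g h = refl
∑-+ (suc n) g h = trans (cong ((g 0 + h 0) +_) (∑-+ n (g ∘ suc) (h ∘ suc))) (interchange (g 0) (h 0) _ _)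

∑-*ˡ : ∀ n c g → ∑ n (λ i → c * g i) ≡ c * ∑ n g
∑-*ˡ zero    c g = sym (*-zeroʳ c)
∑-*ˡ (suc n) c g = trans (cong (c * g 0 +_) (∑-*ˡ n c (g ∘ suc))) (sym (*-distribˡ-+ c _ _))

∑-0 : ∀ n → ∑ n (λ _ → 0ℚ) ≡ 0ℚ
∑-0 zero    = refl
∑-0 (suc n) = trans (+-identityˡ _) (∑-0 n)

∑-suc : ∀ n g → ∑ (suc n) g ≡ ∑ n g + g n
∑-suc zero    g = trans (+-identityʳ (g 0)) (sym (+-identityˡ (g 0)))
∑-suc (suc n) g = trans (cong (g 0 +_) (∑-suc n (g ∘ suc))) (sym (+-assoc (g 0) _ _))

∑-reverse : ∀ n g → ∑ (suc n) g ≡ ∑ (suc n) (λ i → g (n ∸ i))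
∑-reverse zero    g = refl
∑-reverse (suc n) g = begin
  ∑ (suc (suc n)) g                         ≡⟨ ∑-suc (suc n) g ⟩
  ∑ (suc n) g + g (suc n)                   ≡⟨ cong (_+ g (suc n)) (∑-reverse n g) ⟩
  ∑ (suc n) (λ i → g (n ∸ i)) + g (suc n)   ≡⟨ +-comm _ (g (suc n)) ⟩
  ∑ (suc (suc n)) (λ i → g (suc n ∸ i))     ∎
  where open ≡-Reasoning

foldr-map-applyUpTo : ∀ (g : ℕ → ℚ) h n → foldr _+_ 0ℚ (map g (applyUpTo h n)) ≡ ∑ n (g ∘ h)
foldr-map-applyUpTo g h zero    = refl
foldr-map-applyUpTo g h (suc n) = cong (g (h 0) +_) (foldr-map-applyUpTo g (h ∘ suc) n)

ℕtoℚ-sum-applyUpTo : ∀ (φ : ℕ → ℕ) h n → ℕtoℚ (sum (map φ (applyUpTo h n))) ≡ ∑ n (ℕtoℚ ∘ φ ∘ h)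
ℕtoℚ-sum-applyUpTo φ h zero    = refl
ℕtoℚ-sum-applyUpTo φ h (suc n) =
  trans (ℕtoℚ-+ (φ (h 0)) _) (cong (ℕtoℚ (φ (h 0)) +_) (ℕtoℚ-sum-applyUpTo φ (h ∘ suc) n))

ℕtoℚ-sum-splits : ∀ (φ : ℕ → ℕ) m → ℕtoℚ (sum (map φ (splits m))) ≡ ∑ (suc m) (ℕtoℚ ∘ φ ∘ suc)
ℕtoℚ-sum-splits φ m = trans (cong (ℕtoℚ ∘ sum ∘ map φ) (List.map-applyUpTo (λ i → i) suc (suc m)))
                            (ℕtoℚ-sum-applyUpTo φ suc (suc m))

*ₛ-∑ : ∀ a b n → (a *ₛ b) n ≡ ∑ (suc n) (λ i → a i * b (n ∸ i))
*ₛ-∑ a b n = foldr-map-applyUpTo (λ i → a i * b (n ∸ i)) (λ i → i) (suc n)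

*ₛ-comm : ∀ a b → (a *ₛ b) ≗ (b *ₛ a)
*ₛ-comm a b n = begin
  (a *ₛ b) n                                   ≡⟨ *ₛ-∑ a b n ⟩
  ∑ (suc n) (λ i → a i * b (n ∸ i))            ≡⟨ ∑-reverse n (λ i → a i * b (n ∸ i)) ⟩
  ∑ (suc n) (λ i → a (n ∸ i) * b (n ∸ (n ∸ i))) ≡⟨ ∑-cong (suc n) swap ⟩
  ∑ (suc n) (λ i → b i * a (n ∸ i))            ≡⟨ sym (*ₛ-∑ b a n) ⟩
  (b *ₛ a) n                                   ∎
  where
  open ≡-Reasoning
  swap : ∀ i → i < suc n → a (n ∸ i) * b (n ∸ (n ∸ i)) ≡ b i * a (n ∸ i)
  swap i (s≤s i≤n) = trans (cong (λ k → a (n ∸ i) * b k) (ℕₚ.m∸[m∸n]≡n i≤n)) (*-comm (a (n ∸ i)) (b i))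

*ₛ-congˡ : ∀ {a a′} b → a ≗ a′ → (a *ₛ b) ≗ (a′ *ₛ b)
*ₛ-congˡ {a} {a′} b a≗a′ n = trans (*ₛ-∑ a b n)
  (trans (∑-cong (suc n) (λ i _ → cong (_* b (n ∸ i)) (a≗a′ i))) (sym (*ₛ-∑ a′ b n)))

_⊕_ : Series → Series → Series
(a ⊕ b) i = a i + b i

_⋆_ : ℚ → Series → Series
(α ⋆ a) i = α * a i

infixl 6 _⊕_
infixr 7 _⋆_

*ₛ-distribʳ-⊕ : ∀ a b c → ((a ⊕ b) *ₛ c) ≗ (λ n → (a *ₛ c) n + (b *ₛ c) n)
*ₛ-distribʳ-⊕ a b c n = begin
  ((a ⊕ b) *ₛ c) n                                                 ≡⟨ *ₛ-∑ (a ⊕ b) c n ⟩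
  ∑ (suc n) (λ i → (a i + b i) * c (n ∸ i))                        ≡⟨ ∑-cong (suc n) (λ i _ → *-distribʳ-+ (c (n ∸ i)) (a i) (b i)) ⟩
  ∑ (suc n) (λ i → a i * c (n ∸ i) + b i * c (n ∸ i))              ≡⟨ ∑-+ (suc n) (λ i → a i * c (n ∸ i)) (λ i → b i * c (n ∸ i)) ⟩
  ∑ (suc n) (λ i → a i * c (n ∸ i)) + ∑ (suc n) (λ i → b i * c (n ∸ i)) ≡⟨ sym (cong₂ _+_ (*ₛ-∑ a c n) (*ₛ-∑ b c n)) ⟩
  (a *ₛ c) n + (b *ₛ c) n                                          ∎
  where open ≡-Reasoning

*ₛ-⋆ˡ : ∀ α a c → ((α ⋆ a) *ₛ c) ≗ (λ n → α * (a *ₛ c) n)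
*ₛ-⋆ˡ α a c n = begin
  ((α ⋆ a) *ₛ c) n                          ≡⟨ *ₛ-∑ (α ⋆ a) c n ⟩
  ∑ (suc n) (λ i → α * a i * c (n ∸ i))     ≡⟨ ∑-cong (suc n) (λ i _ → *-assoc α (a i) (c (n ∸ i))) ⟩
  ∑ (suc n) (λ i → α * (a i * c (n ∸ i)))   ≡⟨ ∑-*ˡ (suc n) α (λ i → a i * c (n ∸ i)) ⟩
  α * ∑ (suc n) (λ i → a i * c (n ∸ i))     ≡⟨ cong (α *_) (sym (*ₛ-∑ a c n)) ⟩
  α * (a *ₛ c) n                            ∎
  where open ≡-Reasoning

*ₛ-linearˡ : ∀ α a β b c → ((α ⋆ a ⊕ β ⋆ b) *ₛ c) ≗ (λ n → α * (a *ₛ c) n + β * (b *ₛ c) n)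
*ₛ-linearˡ α a β b c n =
  trans (*ₛ-distribʳ-⊕ (α ⋆ a) (β ⋆ b) c n) (cong₂ _+_ (*ₛ-⋆ˡ α a c n) (*ₛ-⋆ˡ β b c n))

*ₛ-identityˡ : ∀ a → (one *ₛ a) ≗ a
*ₛ-identityˡ a n = begin
  (one *ₛ a) n                                   ≡⟨ *ₛ-∑ one a n ⟩
  1ℚ * a n + ∑ n (λ i → 0ℚ * a (n ∸ suc i))      ≡⟨ cong₂ _+_ (*-identityˡ (a n)) (∑-cong n (λ i _ → *-zeroˡ (a (n ∸ suc i)))) ⟩
  a n + ∑ n (λ _ → 0ℚ)                           ≡⟨ cong (a n +_) (∑-0 n) ⟩
  a n + 0ℚ                                       ≡⟨ +-identityʳ (a n) ⟩
  a n                                            ∎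
  where open ≡-Reasoning

*ₛ-identityʳ : ∀ a → (a *ₛ one) ≗ a
*ₛ-identityʳ a n = trans (*ₛ-comm a one n) (*ₛ-identityˡ a n)

*ₛ-without-constants : ∀ a b m → a 0 ≡ 0ℚ → b 0 ≡ 0ℚ →
                       (a *ₛ b) (suc (suc m)) ≡ ∑ (suc m) (λ i → a (suc i) * b (suc m ∸ i))
*ₛ-without-constants a b m a₀≡0 b₀≡0 = begin
  (a *ₛ b) (suc (suc m))
    ≡⟨ *ₛ-∑ a b (suc (suc m)) ⟩
  a 0 * b (suc (suc m)) + ∑ (suc (suc m)) (λ i → a (suc i) * b (suc m ∸ i))
    ≡⟨ cong₂ _+_ (trans (cong (_* b (suc (suc m))) a₀≡0) (*-zeroˡ (b (suc (suc m)))))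
                 (∑-suc (suc m) (λ i → a (suc i) * b (suc m ∸ i))) ⟩
  0ℚ + (interior + a (suc (suc m)) * b (m ∸ m))
    ≡⟨ cong (λ k → 0ℚ + (interior + a (suc (suc m)) * b k)) (ℕₚ.n∸n≡0 m) ⟩
  0ℚ + (interior + a (suc (suc m)) * b 0)
    ≡⟨ cong (λ z → 0ℚ + (interior + a (suc (suc m)) * z)) b₀≡0 ⟩
  0ℚ + (interior + a (suc (suc m)) * 0ℚ)
    ≡⟨ solve 2 (λ x y → con 0ℚ :+ (x :+ y :* con 0ℚ) := x) refl interior (a (suc (suc m))) ⟩
  interior ∎
  where
  open ≡-Reasoning
  interior = ∑ (suc m) (λ i → a (suc i) * b (suc m ∸ i))

*-cancelˡ-nonZero : ∀ p .{{_ : NonZero p}} {x y} → p * x ≡ p * y → x ≡ y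
*-cancelˡ-nonZero p {x} {y} px≡py = begin
  x                ≡⟨ sym (*-identityˡ x) ⟩
  1ℚ * x           ≡⟨ cong (_* x) (sym (*-inverseˡ p)) ⟩
  1/ p * p * x     ≡⟨ *-assoc (1/ p) p x ⟩
  1/ p * (p * x)   ≡⟨ cong (1/ p *_) px≡py ⟩
  1/ p * (p * y)   ≡⟨ sym (*-assoc (1/ p) p y) ⟩
  1/ p * p * y     ≡⟨ cong (_* y) (*-inverseˡ p) ⟩
  1ℚ * y           ≡⟨ *-identityˡ y ⟩
  y                ∎
  where open ≡-Reasoning

cross : Series → ℕ → ℚ
cross a m = ∑ m (λ i → a (suc i) * a (m ∸ i))

*ₛ-square-suc : ∀ a m → (a *ₛ a) (suc m) ≡ (a 0 + a 0) * a (suc m) + cross a m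
*ₛ-square-suc a m = begin
  (a *ₛ a) (suc m)
    ≡⟨ *ₛ-∑ a a (suc m) ⟩
  a 0 * a (suc m) + ∑ (suc m) (λ i → a (suc i) * a (m ∸ i))
    ≡⟨ cong (a 0 * a (suc m) +_) (∑-suc m (λ i → a (suc i) * a (m ∸ i))) ⟩
  a 0 * a (suc m) + (cross a m + a (suc m) * a (m ∸ m))
    ≡⟨ cong (λ k → a 0 * a (suc m) + (cross a m + a (suc m) * a k)) (ℕₚ.n∸n≡0 m) ⟩
  a 0 * a (suc m) + (cross a m + a (suc m) * a 0)
    ≡⟨ solve 3 (λ x y z → x :* y :+ (z :+ y :* x) := (x :+ x) :* y :+ z) refl (a 0) (a (suc m)) (cross a m) ⟩
  (a 0 + a 0) * a (suc m) + cross a m ∎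
  where open ≡-Reasoning

cross-cong : ∀ {a b} m → (∀ i → i ≤ m → a i ≡ b i) → cross a m ≡ cross b m
cross-cong m a≡b = ∑-cong m (λ i i<m → cong₂ _*_ (a≡b (suc i) i<m) (a≡b (m ∸ i) (ℕₚ.m∸n≤m m i)))

-- Comparing coefficient n+1 of a² = b² determines aₙ₊₁ from a₀,…,aₙ, since 2a₀ is invertible.
square-root-unique : ∀ {c} .{{_ : NonZero (c + c)}} {a b : Series} →
                     a 0 ≡ c → b 0 ≡ c → (a *ₛ a) ≗ (b *ₛ b) → a ≗ b
square-root-unique {c} {a} {b} a₀≡c b₀≡c a²≗b² n = agree-upto n n ℕₚ.≤-refl
  where
  open ≡-Reasoning
  agree-upto : ∀ n m → m ≤ n → a m ≡ b m
  agree-upto n       zero    _         = trans a₀≡c (sym b₀≡c)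
  agree-upto (suc n) (suc m) (s≤s m≤n) =
    *-cancelˡ-nonZero (c + c) (∙-cancelʳ (cross a m) _ _ (begin
      (c + c) * a (suc m) + cross a m
        ≡⟨ cong (λ z → (z + z) * a (suc m) + cross a m) (sym a₀≡c) ⟩
      (a 0 + a 0) * a (suc m) + cross a m
        ≡⟨ sym (*ₛ-square-suc a m) ⟩
      (a *ₛ a) (suc m)
        ≡⟨ a²≗b² (suc m) ⟩
      (b *ₛ b) (suc m)
        ≡⟨ *ₛ-square-suc b m ⟩
      (b 0 + b 0) * b (suc m) + cross b m
        ≡⟨ cong₂ (λ z w → (z + z) * b (suc m) + w) b₀≡c
                 (sym (cross-cong m (λ i i≤m → agree-upto n i (ℕₚ.≤-trans i≤m m≤n)))) ⟩
      (c + c) * b (suc m) + cross a m ∎))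

ℕtoℚ-sum-splits-* : ∀ (φ ψ : ℕ → ℕ) {A B : Series} → A 0 ≡ 0ℚ → B 0 ≡ 0ℚ →
                    (∀ i → A i ≡ ℕtoℚ (φ i)) → (∀ i → B i ≡ ℕtoℚ (ψ i)) → ∀ m →
                    ℕtoℚ (sum (map (λ r → φ r ℕ.* ψ (suc (suc m) ∸ r)) (splits m))) ≡ (A *ₛ B) (suc (suc m))
ℕtoℚ-sum-splits-* φ ψ {A} {B} A₀≡0 B₀≡0 A≡φ B≡ψ m = begin
  ℕtoℚ (sum (map (λ r → φ r ℕ.* ψ (suc (suc m) ∸ r)) (splits m)))
    ≡⟨ ℕtoℚ-sum-splits (λ r → φ r ℕ.* ψ (suc (suc m) ∸ r)) m ⟩
  ∑ (suc m) (λ i → ℕtoℚ (φ (suc i) ℕ.* ψ (suc m ∸ i)))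
    ≡⟨ ∑-cong (suc m) (λ i _ → trans (ℕtoℚ-* (φ (suc i)) (ψ (suc m ∸ i)))
                                      (sym (cong₂ _*_ (A≡φ (suc i)) (B≡ψ (suc m ∸ i))))) ⟩
  ∑ (suc m) (λ i → A (suc i) * B (suc m ∸ i))
    ≡⟨ sym (*ₛ-without-constants A B m A₀≡0 B₀≡0) ⟩
  (A *ₛ B) (suc (suc m)) ∎
  where open ≡-Reasoning

X : Series
X (suc zero) = 1ℚ
X _          = 0ℚ

two four eight : ℚ
two   = ℕtoℚ 2
four  = ℕtoℚ 4
eight = ℕtoℚ 8

oneMinus8x-X : oneMinus8x ≗ (λ n → one n - eight * X n)
oneMinus8x-X zero          = refl
oneMinus8x-X (suc zero)    = refl
oneMinus8x-X (suc (suc n)) = refl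

inner-X : ∀ s → inner s ≗ (λ n → two * one n + two * s n + eight * X n)
inner-X s zero          = solve 1 (λ a → con two :+ con two :* a := con two :* con 1ℚ :+ con two :* a :+ con eight :* con 0ℚ) refl (s 0)
inner-X s (suc zero)    = solve 1 (λ a → con two :* a :+ con eight := con two :* con 0ℚ :+ con two :* a :+ con eight :* con 1ℚ) refl (s 1)
inner-X s (suc (suc n)) = solve 1 (λ a → con two :* a := con two :* con 0ℚ :+ con two :* a :+ con eight :* con 0ℚ) refl (s (suc (suc n)))

inner-cong : ∀ {s t} → s ≗ t → inner s ≗ inner t
inner-cong s≗t zero          = cong (λ z → ℕtoℚ 2 + ℕtoℚ 2 * z) (s≗t 0)
inner-cong s≗t (suc zero)    = cong (λ z → ℕtoℚ 2 * z + ℕtoℚ 8) (s≗t 1)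
inner-cong s≗t (suc (suc n)) = cong (ℕtoℚ 2 *_) (s≗t (suc (suc n)))

*ₛ-square-linear : ∀ α a β b → ((α ⋆ a ⊕ β ⋆ b) *ₛ (α ⋆ a ⊕ β ⋆ b)) ≗
                   (λ n → α * α * (a *ₛ a) n + two * α * β * (b *ₛ a) n + β * β * (b *ₛ b) n)
*ₛ-square-linear α a β b n = begin
  (c *ₛ c) n
    ≡⟨ *ₛ-linearˡ α a β b c n ⟩
  α * (a *ₛ c) n + β * (b *ₛ c) n
    ≡⟨ cong₂ (λ p q → α * p + β * q) (*ₛ-comm a c n) (*ₛ-comm b c n) ⟩
  α * (c *ₛ a) n + β * (c *ₛ b) n
    ≡⟨ cong₂ (λ p q → α * p + β * q) (*ₛ-linearˡ α a β b a n) (*ₛ-linearˡ α a β b b n) ⟩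
  α * (α * (a *ₛ a) n + β * (b *ₛ a) n) + β * (α * (a *ₛ b) n + β * (b *ₛ b) n)
    ≡⟨ cong (λ p → α * (α * (a *ₛ a) n + β * (b *ₛ a) n) + β * (α * p + β * (b *ₛ b) n)) (*ₛ-comm a b n) ⟩
  α * (α * (a *ₛ a) n + β * (b *ₛ a) n) + β * (α * (b *ₛ a) n + β * (b *ₛ b) n)
    ≡⟨ solve 5 (λ α β aa ba bb → α :* (α :* aa :+ β :* ba) :+ β :* (α :* ba :+ β :* bb)
                               := α :* α :* aa :+ con two :* α :* β :* ba :+ β :* β :* bb)
             refl α β ((a *ₛ a) n) ((b *ₛ a) n) ((b *ₛ b) n) ⟩
  α * α * (a *ₛ a) n + two * α * β * (b *ₛ a) n + β * β * (b *ₛ b) n ∎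
  where
  open ≡-Reasoning
  c = α ⋆ a ⊕ β ⋆ b

module FunctionalEquations
  (K G F : Series) (K₀≡0 : K 0 ≡ 0ℚ) (F₀≡0 : F 0 ≡ 0ℚ)
  (K-eq : K ≗ (λ n → two * X n + (K *ₛ K) n))
  (G+F≡K : ∀ n → G n + F n ≡ K n)
  (F-eq : F ≗ (λ n → X n + (G *ₛ F) n)) where

  open ≡-Reasoning

  s W u : Series
  s = 1ℚ ⋆ one ⊕ (- two) ⋆ K
  W = two ⋆ one ⊕ (- two) ⋆ K
  u = four ⋆ F ⊕ 1ℚ ⋆ W

  K² : ∀ n → (K *ₛ K) n ≡ K n - two * X n
  K² n = trans (solve 2 (λ kk x → kk := con two :* x :+ kk :- con two :* x) refl ((K *ₛ K) n) (X n))
               (cong (_- two * X n) (sym (K-eq n)))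

  F² : ∀ n → (F *ₛ F) n ≡ X n + (K *ₛ F) n - F n
  F² n = begin
    (F *ₛ F) n
      ≡⟨ solve 4 (λ ff f x kf → ff := x :+ kf :- (x :+ (con 1ℚ :* kf :+ con (- 1ℚ) :* ff)))
               refl ((F *ₛ F) n) (F n) (X n) ((K *ₛ F) n) ⟩
    X n + (K *ₛ F) n - (X n + (1ℚ * (K *ₛ F) n + (- 1ℚ) * (F *ₛ F) n))
      ≡⟨ cong (λ z → X n + (K *ₛ F) n - (X n + z))
              (sym (trans (*ₛ-congˡ F G≗K-F n) (*ₛ-linearˡ 1ℚ K (- 1ℚ) F F n))) ⟩
    X n + (K *ₛ F) n - (X n + (G *ₛ F) n)
      ≡⟨ cong (λ z → X n + (K *ₛ F) n - z) (sym (F-eq n)) ⟩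
    X n + (K *ₛ F) n - F n ∎
    where
    G≗K-F : G ≗ (1ℚ ⋆ K ⊕ (- 1ℚ) ⋆ F)
    G≗K-F i = trans (solve 2 (λ g f → g := con 1ℚ :* (g :+ f) :+ con (- 1ℚ) :* f) refl (G i) (F i))
                    (cong (λ k → 1ℚ * k + (- 1ℚ) * F i) (G+F≡K i))

  α-2K-squared : ∀ α n → ((α ⋆ one ⊕ (- two) ⋆ K) *ₛ (α ⋆ one ⊕ (- two) ⋆ K)) n ≡
                                α * α * one n - four * α * K n + four * (K n - two * X n)
  α-2K-squared α n = begin
    _ ≡⟨ *ₛ-square-linear α one (- two) K n ⟩
    α * α * (one *ₛ one) n + two * α * (- two) * (K *ₛ one) n + (- two) * (- two) * (K *ₛ K) n
      ≡⟨ cong₂ _+_ (cong₂ (λ p q → α * α * p + two * α * (- two) * q) (*ₛ-identityˡ one n) (*ₛ-identityʳ K n))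
                   (cong ((- two) * (- two) *_) (K² n)) ⟩
    α * α * one n + two * α * (- two) * K n + (- two) * (- two) * (K n - two * X n)
      ≡⟨ solve 4 (λ α o k x → α :* α :* o :+ con two :* α :* con (- two) :* k :+ con (- two) :* con (- two) :* (k :- con two :* x)
                            := α :* α :* o :- con four :* α :* k :+ con four :* (k :- con two :* x))
               refl α (one n) (K n) (X n) ⟩
    α * α * one n - four * α * K n + four * (K n - two * X n) ∎

  s-square : (s *ₛ s) ≗ oneMinus8x
  s-square n = begin
    (s *ₛ s) n
      ≡⟨ α-2K-squared 1ℚ n ⟩
    1ℚ * 1ℚ * one n - four * 1ℚ * K n + four * (K n - two * X n)
      ≡⟨ solve 3 (λ o k x → con 1ℚ :* con 1ℚ :* o :- con four :* con 1ℚ :* k :+ con four :* (k :- con two :* x)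
                          := o :- con eight :* x) refl (one n) (K n) (X n) ⟩
    one n - eight * X n
      ≡⟨ sym (oneMinus8x-X n) ⟩
    oneMinus8x n ∎

  u-square : (u *ₛ u) ≗ inner s
  u-square n = begin
    (u *ₛ u) n
      ≡⟨ *ₛ-square-linear four F 1ℚ W n ⟩
    four * four * (F *ₛ F) n + two * four * 1ℚ * (W *ₛ F) n + 1ℚ * 1ℚ * (W *ₛ W) n
      ≡⟨ cong₂ (λ p q → four * four * p + two * four * 1ℚ * q + 1ℚ * 1ℚ * (W *ₛ W) n) (F² n) W*F ⟩
    four * four * (X n + KF - F n) + two * four * 1ℚ * (two * F n + (- two) * KF) + 1ℚ * 1ℚ * (W *ₛ W) n
      ≡⟨ cong (λ p → four * four * (X n + KF - F n) + two * four * 1ℚ * (two * F n + (- two) * KF) + 1ℚ * 1ℚ * p)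
              (α-2K-squared two n) ⟩
    four * four * (X n + KF - F n) + two * four * 1ℚ * (two * F n + (- two) * KF)
      + 1ℚ * 1ℚ * (two * two * one n - four * two * K n + four * (K n - two * X n))
      ≡⟨ solve 5 (λ x kf f o k →
           con four :* con four :* (x :+ kf :- f) :+ con two :* con four :* con 1ℚ :* (con two :* f :+ con (- two) :* kf)
             :+ con 1ℚ :* con 1ℚ :* (con two :* con two :* o :- con four :* con two :* k :+ con four :* (k :- con two :* x))
           := con two :* o :+ con two :* (con 1ℚ :* o :+ con (- two) :* k) :+ con eight :* x)
           refl (X n) KF (F n) (one n) (K n) ⟩
    two * one n + two * s n + eight * X n
      ≡⟨ sym (inner-X s n) ⟩
    inner s n ∎
    where
    KF = (K *ₛ F) n
    W*F : (W *ₛ F) n ≡ two * F n + (- two) * KF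
    W*F = trans (*ₛ-linearˡ two one (- two) K F n) (cong (λ p → two * p + (- two) * KF) (*ₛ-identityˡ F n))

  s₀≡1 : s 0 ≡ 1ℚ
  s₀≡1 = cong (λ k → 1ℚ * 1ℚ + (- two) * k) K₀≡0

  u₀≡2 : u 0 ≡ ℕtoℚ 2
  u₀≡2 = cong₂ (λ p k → four * p + 1ℚ * (two * 1ℚ + (- two) * k)) F₀≡0 K₀≡0

  F≗rhs : F ≗ rhs s u
  F≗rhs n = solve 3 (λ f o k → f := (con 0ℚ :- o :- (con 1ℚ :* o :+ con (- two) :* k)
                                     :+ (con four :* f :+ con 1ℚ :* (con two :* o :+ con (- two) :* k))) :* con (ℤ.+ 1 / 4))
                    refl (F n) (one n) (K n)

  roots-determine-F : ∀ s′ u′ → IsSqrt1 s′ → IsSqrt2 s′ u′ → F ≗ rhs s′ u′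
  roots-determine-F s′ u′ (s′² , s′₀≡1) (u′² , u′₀≡2) n =
    trans (F≗rhs n) (cong₂ (λ p q → ((0ℚ - one n) - p + q) * (ℤ.+ 1 / 4)) (sym (s′≗s n)) (sym (u′≗u n)))
    where
    s′≗s : s′ ≗ s
    s′≗s = square-root-unique s′₀≡1 s₀≡1 (λ k → trans (s′² k) (sym (s-square k)))
    u′≗u : u′ ≗ u
    u′≗u = square-root-unique u′₀≡2 u₀≡2 (λ k → trans (u′² k) (trans (inner-cong s′≗s k) (sym (u-square k))))

Rows TrueRows : Series
Rows n     = ℕtoℚ (total rows n)
TrueRows n = ℕtoℚ (total trueRows n)

F≡ℕtoℚf : ∀ n → F n ≡ ℕtoℚ (f n)
F≡ℕtoℚf zero    = refl
F≡ℕtoℚf (suc n) = refl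

Rows-eq : Rows ≗ (λ n → two * X n + (Rows *ₛ Rows) n)
Rows-eq zero          = refl
Rows-eq (suc zero)    = refl
Rows-eq (suc (suc m)) = begin
  Rows (suc (suc m))
    ≡⟨ cong ℕtoℚ (total-rows-⇒ m) ⟩
  ℕtoℚ (sum (map (λ r → total rows r ℕ.* total rows (suc (suc m) ∸ r)) (splits m)))
    ≡⟨ ℕtoℚ-sum-splits-* (total rows) (total rows) refl refl (λ _ → refl) (λ _ → refl) m ⟩
  (Rows *ₛ Rows) (suc (suc m))
    ≡⟨ sym (trans (cong (_+ (Rows *ₛ Rows) (suc (suc m))) (*-zeroʳ two)) (+-identityˡ _)) ⟩
  two * 0ℚ + (Rows *ₛ Rows) (suc (suc m)) ∎
  where open ≡-Reasoning

TrueRows+F≡Rows : ∀ n → TrueRows n + F n ≡ Rows n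
TrueRows+F≡Rows n = begin
  TrueRows n + F n                        ≡⟨ cong (TrueRows n +_) (F≡ℕtoℚf n) ⟩
  ℕtoℚ (total trueRows n) + ℕtoℚ (f n)    ≡⟨ sym (ℕtoℚ-+ (total trueRows n) (f n)) ⟩
  ℕtoℚ (total trueRows n ℕ.+ f n)         ≡⟨ cong ℕtoℚ (total-trueRows+f n) ⟩
  Rows n                                  ∎
  where open ≡-Reasoning

F-eq : F ≗ (λ n → X n + (TrueRows *ₛ F) n)
F-eq zero          = refl
F-eq (suc zero)    = refl
F-eq (suc (suc m)) = begin
  ℕtoℚ (f (suc (suc m)))
    ≡⟨ cong ℕtoℚ (f-⇒ m) ⟩
  ℕtoℚ (sum (map (λ r → total trueRows r ℕ.* f (suc (suc m) ∸ r)) (splits m)))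
    ≡⟨ ℕtoℚ-sum-splits-* (total trueRows) f refl refl (λ _ → refl) F≡ℕtoℚf m ⟩
  (TrueRows *ₛ F) (suc (suc m))
    ≡⟨ sym (+-identityˡ _) ⟩
  0ℚ + (TrueRows *ₛ F) (suc (suc m)) ∎
  where open ≡-Reasoning

open FunctionalEquations Rows TrueRows F refl refl Rows-eq TrueRows+F≡Rows F-eq

proposition2p3 : (∃₂ λ s u → IsSqrt1 s × IsSqrt2 s u)
    × (∀ s u → IsSqrt1 s → IsSqrt2 s u → ∀ n → F n ≡ rhs s u n)
proposition2p3 = (s , u , (s-square , s₀≡1) , (u-square , u₀≡2)) , roots-determine-F
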